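{- For every $N\ge2$, $m\ge0$ and every word $\mathbf w\in\{\pm1,\dots,\pm(N-1)\}^m$, the plabic fence $G(\mathbf w)$ is simple.
   Context: Plabic fence $G(\mathbf w)$ for $\mathbf w=(i_1,\dots,i_m)$: in a disk, draw $N$ horizontal strands numbered $1,\dots,N$ from bottom to top, with both endpoints on the boundary circle (these $2N$ endpoints are the boundary vertices); then for $j=1,\dots,m$ from left to right, with $h=|i_j|$, add a vertical bridge edge between strands $h$ and $h+1$, with a black vertex on strand $h$ and a white vertex on strand $h+1$ if $i_j>0$, and the colors reversed if $i_j<0$. For a plabic graph $G$, $Q_G$ has one vertex per interior face (face not adjacent to the boundary circle) and, for each edge with differently colored endpoints whose two adjacent faces $F,F'$ are interior (possibly equal), an arrow between $F$ and $F'$ oriented with the white endpoint on the left. $G$ is simple if $Q_G$ has no directed cycles of length 1 or 2. -}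

module Defs where

open import Data.Nat using (ℕ; zero; suc; _+_; _∸_; _≤_; _<_; _≡ᵇ_)
open import Data.Integer using (ℤ; +_; -[1+_]; ∣_∣)
import Data.Integer as ℤ
open import Data.Fin using (Fin; toℕ)
open import Data.Vec using (Vec; lookup; toList)
open import Data.List using (List; []; _∷_; take)
open import Data.Bool using (Bool; true; false; if_then_else_)
open import Data.Product using (_×_; _,_)
open import Data.Sum using (_⊎_)
open import Data.Empty using (⊥)
open import Relation.Binary.PropositionalEquality using (_≡_; _≢_)
open import Relation.Nullary using (¬_)

ValidLetter : ℕ → ℤ → Set
ValidLetter N i = (1 ≤ ∣ i ∣) × (∣ i ∣ < N)

ValidWord : ∀ {m} → ℕ → Vec ℤ m → Set
ValidWord N w = ∀ j → ValidLetter N (lookup w j)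

-- the bridge for letter i joins strands ∣ i ∣ and ∣ i ∣ + 1
level : ℤ → ℕ
level i = ∣ i ∣

data Colour : Set where
  black white : Colour

-- colour of the vertex of the bridge of letter i on strand s
-- (s is either level i (lower end) or level i + 1 (upper end)):
-- i > 0 : black on the lower strand, white on the upper strand;
-- i < 0 : colours reversed.
lowerColour : ℤ → Colour
lowerColour (+ _)     = black
lowerColour -[1+ _ ]  = white

upperColour : ℤ → Colour
upperColour (+ _)     = white
upperColour -[1+ _ ]  = black

colourAt : ℤ → ℕ → Colour
colourAt i s = if s ≡ᵇ level i then lowerColour i else upperColour i

Touches : ℤ → ℕ → Set
Touches i s = (level i ≡ s) ⊎ (suc (level i) ≡ s)

-- Strip t (0 ≤ t ≤ N) is the region between strand t and strand
-- t+1 (strip 0 lies below strand 1, strip N above strand N).  The bridges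
-- at level t cut strip t into regions; a face is a pair (t , c) meaning
-- the region of strip t lying to the right of exactly c of the level-t
-- bridges.  Faces with c = 0 or c = (number of level-t bridges), as well
-- as strips 0 and N, touch the boundary circle; the others are interior.

Face : Set
Face = ℕ × ℕ

countLevel : ℕ → List ℤ → ℕ
countLevel t []       = 0
countLevel t (i ∷ is) = (if level i ≡ᵇ t then 1 else 0) + countLevel t is

countUpTo : ∀ {m} → Vec ℤ m → ℕ → ℕ → ℕ
countUpTo w t x = countLevel t (take (suc x) (toList w))

total : ∀ {m} → Vec ℤ m → ℕ → ℕ
total w t = countLevel t (toList w)

Interior : ∀ {m} → ℕ → Vec ℤ m → Face → Set
Interior N w (t , c) = (1 ≤ t) × (t < N) × (1 ≤ c) × (c < total w t)

IsStrandEdge : ∀ {m} → ℕ → Vec ℤ m → ℕ → Fin m → Fin m → Set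
IsStrandEdge N w s j j' =
  (1 ≤ s) × (s ≤ N) × Touches (lookup w j) s × Touches (lookup w j') s
  × (toℕ j < toℕ j')
  × (∀ k → toℕ j < toℕ k → toℕ k < toℕ j' → ¬ Touches (lookup w k) s)

-- The quiver Q_{G(w)}: Arrow N w F F' is the type of arrows F → F'.
-- There is one arrow for every bicoloured edge whose two adjacent faces
-- are interior, oriented so that the white endpoint is on the left.
--
-- * bridge at position j, level t = ∣ w_j ∣, c = countUpTo w t j:
--   left face (t , c ∸ 1), right face (t , c).  Crossing left → right,
--   the upper endpoint is on the left; it is white iff w_j > 0.
-- * strand edge on strand s between positions j < j': lower face
--   (s ∸ 1 , countUpTo w (s ∸ 1) j), upper face (s , countUpTo w s j).
--   Crossing upward, the endpoint at j is on the left.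
-- Boundary vertices are uncoloured, so edges incident to them give no arrow.

data Arrow {m : ℕ} (N : ℕ) (w : Vec ℤ m) : Face → Face → Set where
  bridge : (j : Fin m) →
    let t = level (lookup w j) ; c = countUpTo w t (toℕ j) in
    Interior N w (t , c ∸ 1) → Interior N w (t , c) →
    upperColour (lookup w j) ≡ white →
    Arrow N w (t , c ∸ 1) (t , c)
  bridge⁻ : (j : Fin m) →
    let t = level (lookup w j) ; c = countUpTo w t (toℕ j) in
    Interior N w (t , c ∸ 1) → Interior N w (t , c) →
    upperColour (lookup w j) ≡ black →
    Arrow N w (t , c) (t , c ∸ 1)
  strandUp : (s : ℕ) (j j' : Fin m) → IsStrandEdge N w s j j' →
    let below = (s ∸ 1 , countUpTo w (s ∸ 1) (toℕ j))
        above = (s , countUpTo w s (toℕ j)) in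
    Interior N w below → Interior N w above →
    colourAt (lookup w j) s ≡ white → colourAt (lookup w j') s ≡ black →
    Arrow N w below above
  strandDown : (s : ℕ) (j j' : Fin m) → IsStrandEdge N w s j j' →
    let below = (s ∸ 1 , countUpTo w (s ∸ 1) (toℕ j))
        above = (s , countUpTo w s (toℕ j)) in
    Interior N w below → Interior N w above →
    colourAt (lookup w j) s ≡ black → colourAt (lookup w j') s ≡ white →
    Arrow N w above below

Simple : ∀ {m} → ℕ → Vec ℤ m → Set
Simple N w =
  (∀ F → ¬ Arrow N w F F)
  × (∀ F F' → F ≢ F' → Arrow N w F F' → Arrow N w F' F → ⊥)

{-# OPTIONS --safe #-}
-- Every arrow of Q_{G(w)} crosses an edge of G(w) between the two faces adjacent
-- to it, in the direction fixed by the colour of one endpoint.  The two sides of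
-- an edge are always distinct faces, so there are no loops.  Two edges cannot
-- have swapped sides, and two edges with the same sides have the same
-- distinguished endpoint, because the number of level-t bridges up to a
-- position strictly grows at every level-t bridge.  Hence the arrows of a 2-cycle would have to cross one
-- edge in both directions, which its colour forbids.
module Submission where

open import Defs
open import Data.Nat using (ℕ; suc; _∸_; _≤_; _<_; _≡ᵇ_; s≤s; z≤n)
open import Data.Integer using (ℤ)
open import Data.Nat.Properties using (1+n≢n; m∸n≤m; +-monoʳ-<; ≡⇒≡ᵇ)
import Data.Nat.Properties as ℕ
open import Data.Fin using (Fin; toℕ) renaming (zero to fzero; suc to fsuc)
open import Data.Fin.Properties using (<-cmp)
open import Data.Vec using (Vec; _∷_; lookup)
open import Data.Bool using (true; false)
open import Data.Product using (_,_; proj₁; proj₂)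
open import Data.Product.Properties using (,-injective)
open import Data.Sum using (_⊎_; inj₁; inj₂)
open import Data.Empty using (⊥; ⊥-elim)
open import Function using (_∘_)
open import Relation.Binary using (tri<; tri≈; tri>)
open import Relation.Binary.PropositionalEquality

∸1≢ : ∀ {n} → 1 ≤ n → n ∸ 1 ≢ n
∸1≢ {suc n} _ = 1+n≢n ∘ sym

∸1-no-swap : ∀ {a b} → 1 ≤ a → a ∸ 1 ≡ b → a ≡ b ∸ 1 → ⊥
∸1-no-swap {suc a} _ refl e = ℕ.<-irrefl (sym e) (s≤s (m∸n≤m a 1))

white≢black : white ≢ black
white≢black ()

Touches⇒level : ∀ {i s} → Touches i s → level i ≡ s ⊎ level i ≡ s ∸ 1
Touches⇒level (inj₁ e) = inj₁ e
Touches⇒level (inj₂ e) = inj₂ (cong (_∸ 1) e)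

countUpTo-pos : ∀ {m t} (w : Vec ℤ m) (k : Fin m) → level (lookup w k) ≡ t →
                0 < countUpTo w t (toℕ k)
countUpTo-pos (i ∷ w) fzero refl with level i ≡ᵇ level i | ≡⇒≡ᵇ (level i) (level i) refl
... | true  | _ = s≤s z≤n
... | false | ()
countUpTo-pos (i ∷ w) (fsuc k) eq = ℕ.≤-trans (countUpTo-pos w k eq) (ℕ.m≤n+m _ _)

countUpTo-strictMono : ∀ {m t} (w : Vec ℤ m) (j k : Fin m) → toℕ j < toℕ k →
                       level (lookup w k) ≡ t → countUpTo w t (toℕ j) < countUpTo w t (toℕ k)
countUpTo-strictMono (i ∷ w) fzero    (fsuc k) _         eq = +-monoʳ-< _ (countUpTo-pos w k eq)
countUpTo-strictMono (i ∷ w) (fsuc j) (fsuc k) (s≤s j<k) eq =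
  +-monoʳ-< _ (countUpTo-strictMono w j k j<k eq)

module _ {m : ℕ} (w : Vec ℤ m) where

  count : ℕ → Fin m → ℕ
  count t j = countUpTo w t (toℕ j)

  level-counts-differ : ∀ {t} {j k : Fin m} → toℕ j < toℕ k → level (lookup w k) ≡ t →
                        count t j ≢ count t k
  level-counts-differ j<k ek eq = ℕ.<-irrefl eq (countUpTo-strictMono w _ _ j<k ek)

  count-injective : ∀ {t} {j k : Fin m} →
                    level (lookup w j) ≡ t → level (lookup w k) ≡ t →
                    count t j ≡ count t k → j ≡ k
  count-injective {j = j} {k} ej ek eq with <-cmp j k
  ... | tri< j<k _ _ = ⊥-elim (level-counts-differ j<k ek eq)
  ... | tri≈ _ j≡k _ = j≡k
  ... | tri> _ _ k<j = ⊥-elim (level-counts-differ k<j ej (sym eq))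

  touching-counts-differ : ∀ {s} {j k : Fin m} → toℕ j < toℕ k → Touches (lookup w k) s →
                           count s j ≡ count s k → count (s ∸ 1) j ≢ count (s ∸ 1) k
  touching-counts-differ {k = k} j<k tk eq eq′ with Touches⇒level {lookup w k} tk
  ... | inj₁ ek = level-counts-differ j<k ek eq
  ... | inj₂ ek = level-counts-differ j<k ek eq′

  count-injective-Touches : ∀ {s} {j k : Fin m} →
                            Touches (lookup w j) s → Touches (lookup w k) s →
                            count s j ≡ count s k → count (s ∸ 1) j ≡ count (s ∸ 1) k → j ≡ k
  count-injective-Touches {j = j} {k} tj tk eq eq′ with <-cmp j k
  ... | tri< j<k _ _ = ⊥-elim (touching-counts-differ j<k tk eq eq′)
  ... | tri≈ _ j≡k _ = j≡k
  ... | tri> _ _ k<j = ⊥-elim (touching-counts-differ k<j tj (sym eq) (sym eq′))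

  -- A strand edge is named by its left endpoint j on strand s.  face₀ lies left
  -- of a bridge or below a strand edge, and arrows cross from face₀ to face₁
  -- exactly when keyColour is white.
  data Edge : Set where
    bridgeAt : Fin m → Edge
    strandAt : (s : ℕ) (j : Fin m) → 1 ≤ s → Touches (lookup w j) s → Edge

  face₀ face₁ : Edge → Face
  face₀ (bridgeAt j)       = level (lookup w j) , count (level (lookup w j)) j ∸ 1
  face₀ (strandAt s j _ _) = s ∸ 1 , count (s ∸ 1) j
  face₁ (bridgeAt j)       = level (lookup w j) , count (level (lookup w j)) j
  face₁ (strandAt s j _ _) = s , count s j

  keyColour : Edge → Colour
  keyColour (bridgeAt j)       = upperColour (lookup w j)
  keyColour (strandAt s j _ _) = colourAt (lookup w j) s

  data Crossing (F F′ : Face) : Set where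
    forward  : (e : Edge) → face₀ e ≡ F → face₁ e ≡ F′ → keyColour e ≡ white → Crossing F F′
    backward : (e : Edge) → face₁ e ≡ F → face₀ e ≡ F′ → keyColour e ≡ black → Crossing F F′

  arrow⇒crossing : ∀ {N F F′} → Arrow N w F F′ → Crossing F F′
  arrow⇒crossing (bridge j _ _ col) = forward (bridgeAt j) refl refl col
  arrow⇒crossing (bridge⁻ j _ _ col) = backward (bridgeAt j) refl refl col
  arrow⇒crossing (strandUp s j _ (s≥1 , _ , tj , _) _ _ col _) =
    forward (strandAt s j s≥1 tj) refl refl col
  arrow⇒crossing (strandDown s j _ (s≥1 , _ , tj , _) _ _ col _) =
    backward (strandAt s j s≥1 tj) refl refl col

  face₀≢face₁ : ∀ e → face₀ e ≢ face₁ e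
  face₀≢face₁ (bridgeAt j)         = ∸1≢ (countUpTo-pos w j refl) ∘ cong proj₂
  face₀≢face₁ (strandAt s j s≥1 _) = ∸1≢ s≥1 ∘ cong proj₁

  faces-not-swapped : ∀ e e′ → face₀ e ≡ face₁ e′ → face₁ e ≡ face₀ e′ → ⊥
  faces-not-swapped (bridgeAt j) (bridgeAt _) p q =
    ∸1-no-swap (countUpTo-pos w j refl) (cong proj₂ p) (cong proj₂ q)
  faces-not-swapped (bridgeAt _) (strandAt _ _ s≥1 _) p q =
    ∸1≢ s≥1 (trans (sym (cong proj₁ q)) (cong proj₁ p))
  faces-not-swapped (strandAt _ _ s≥1 _) (bridgeAt _) p q =
    ∸1≢ s≥1 (trans (cong proj₁ p) (sym (cong proj₁ q)))
  faces-not-swapped (strandAt _ _ s≥1 _) (strandAt _ _ _ _) p q =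
    ∸1-no-swap s≥1 (cong proj₁ p) (cong proj₁ q)

  same-faces⇒same-keyColour : ∀ e e′ → face₀ e ≡ face₀ e′ → face₁ e ≡ face₁ e′ →
                              keyColour e ≡ keyColour e′
  same-faces⇒same-keyColour (bridgeAt j) (bridgeAt k) _ q =
    cong (upperColour ∘ lookup w) (count-injective levels-eq refl counts-eq)
    where
    levels-eq : level (lookup w j) ≡ level (lookup w k)
    levels-eq = cong proj₁ q
    counts-eq : count (level (lookup w k)) j ≡ count (level (lookup w k)) k
    counts-eq = trans (cong (λ t → count t j) (sym levels-eq)) (cong proj₂ q)
  same-faces⇒same-keyColour (bridgeAt _) (strandAt _ _ s≥1 _) p q =
    ⊥-elim (∸1≢ s≥1 (trans (sym (cong proj₁ p)) (cong proj₁ q)))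
  same-faces⇒same-keyColour (strandAt _ _ s≥1 _) (bridgeAt _) p q =
    ⊥-elim (∸1≢ s≥1 (trans (cong proj₁ p) (sym (cong proj₁ q))))
  same-faces⇒same-keyColour (strandAt s j _ tj) (strandAt _ k _ tk) p q
    with ,-injective p | ,-injective q
  ... | _ , eq′ | refl , eq =
    cong (λ i → colourAt (lookup w i) s) (count-injective-Touches tj tk eq eq′)

  no-loop : ∀ {F} → Crossing F F → ⊥
  no-loop (forward  e p q _) = face₀≢face₁ e (trans p (sym q))
  no-loop (backward e p q _) = face₀≢face₁ e (trans q (sym p))

  no-2-cycle : ∀ {F F′} → Crossing F F′ → Crossing F′ F → ⊥
  no-2-cycle (forward e p q _) (forward e′ p′ q′ _) =
    faces-not-swapped e e′ (trans p (sym q′)) (trans q (sym p′))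
  no-2-cycle (forward e p q is-white) (backward e′ p′ q′ is-black) =
    white≢black (trans (sym is-white)
      (trans (same-faces⇒same-keyColour e e′ (trans p (sym q′)) (trans q (sym p′))) is-black))
  no-2-cycle (backward e p q is-black) (forward e′ p′ q′ is-white) =
    white≢black (trans (sym is-white)
      (trans (same-faces⇒same-keyColour e′ e (trans p′ (sym q)) (trans q′ (sym p))) is-black))
  no-2-cycle (backward e p q _) (backward e′ p′ q′ _) =
    faces-not-swapped e′ e (trans q′ (sym p)) (trans p′ (sym q))

proposition7p8 : (N : ℕ) → 2 ≤ N → (m : ℕ) → (w : Vec ℤ m) →
    ValidWord N w → Simple N w
proposition7p8 N _ m w _ =
  (λ F → no-loop w ∘ arrow⇒crossing w) ,
  (λ F F′ _ a b → no-2-cycle w (arrow⇒crossing w a) (arrow⇒crossing w b))
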